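{- Let $M$ be an EPCF program with $M\twoheadrightarrow_{\mathtt{wh}}\underline n$. Then $M^{\downarrow}\twoheadrightarrow_{\mathsf{PCF}}\underline n$.
   Context: PCF terms: $P::=x\mid \lambda x.P\mid P\cdot Q\mid \mathbf{fix}\,P\mid \mathbf{0}\mid \mathbf{pred}\,P\mid \mathbf{succ}\,P\mid \mathbf{ifz}(P,Q,Q')$, up to $\alpha$-conversion, $\underline n=\mathbf{succ}^n(\mathbf 0)$. PCF evaluation contexts $E::=\square\mid E\cdot P\mid\mathbf{pred}\,E\mid\mathbf{succ}\,E\mid\mathbf{ifz}(E,P,Q)$; $\to_{\mathsf{PCF}}$: $E[(\lambda x.P)Q]\to E[P\{Q/x\}]$, $E[\mathbf{fix}\,P]\to E[P\cdot\mathbf{fix}\,P]$, $E[\mathbf{pred}(\mathbf{succ}\,\underline n)]\to E[\underline n]$, $E[\mathbf{pred}\,\mathbf 0]\to E[\mathbf 0]$, $E[\mathbf{ifz}(\mathbf 0,P_1,P_2)]\to E[P_1]$, $E[\mathbf{ifz}(\underline{n+1},P_1,P_2)]\to E[P_2]$; $\twoheadrightarrow_{\mathsf{PCF}}$ reflexive-transitive closure. EPCF terms add explicit substitutions $M\langle N/x\rangle$ ($x$ bound in $M$). For $\sigma=\langle N_1/x_1\rangle\cdots\langle N_n/x_n\rangle$ ($x_i$ distinct), $M^\sigma=(\cdots(M\langle N_1/x_1\rangle)\cdots)\langle N_n/x_n\rangle$, $\sigma(x_i)=N_i$. An EPCF program is a closed EPCF term all of whose subterms $M\langle N/x\rangle$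 have $N$ closed. $\to_{\mathtt{wh}}$ is the union of: computation steps $E[(\lambda x.M)^\sigma N]\to E[M^\sigma\langle N/x\rangle]$, $E[\mathbf{pred}\,\mathbf 0]\to E[\mathbf 0]$, $E[\mathbf{pred}\,\underline{n+1}]\to E[\underline n]$, $E[\mathbf{ifz}(\mathbf 0,M,N)]\to E[M]$, $E[\mathbf{ifz}(\underline{n+1},M,N)]\to E[N]$, $E[\mathbf{fix}\,M]\to E[M(\mathbf{fix}\,M)]$; and percolation steps (σ nonempty) $E[x^\sigma]\to E[N]$ if $\sigma(x)=N$, $E[y^\sigma]\to E[y]$ if $y\notin\mathrm{dom}\sigma$, $E[\mathbf 0^\sigma]\to E[\mathbf 0]$, $E[(M\cdot N)^\sigma]\to E[M^\sigma\cdot N^\sigma]$, $E[(\mathbf{pred}\,M)^\sigma]\to E[\mathbf{pred}(M^\sigma)]$, $E[(\mathbf{succ}\,M)^\sigma]\to E[\mathbf{succ}(M^\sigma)]$, $E[\mathbf{ifz}(L,M,N)^\sigma]\to E[\mathbf{ifz}(L^\sigma,M^\sigma,N^\sigma)]$, $E[(\mathbf{fix}\,M)^\sigma]\to E[\mathbf{fix}(M^\sigma)]$ (EPCF evaluation contexts as for PCF). $\twoheadrightarrow_{\mathtt{wh}}$ is the reflexive-transitive closure. The collapse $M^\downarrow$ performs all explicit substitutions: it commutes with all PCF constructors and $(M\langle N/x\rangle)^\downarrow=M^\downarrow\{N^\downarrow/x\}$. -}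

module Defs where

open import Data.Nat using (ℕ; zero; suc; _+_)
open import Data.Fin using (Fin; _↑ˡ_; _↑ʳ_; splitAt)
import Data.Fin as F
open import Data.Sum using (_⊎_; inj₁; inj₂; [_,_])
open import Data.Product using (Σ)
open import Data.List using (List; []; _∷_; length; lookup)
open import Relation.Binary.PropositionalEquality using (_≡_)
open import Relation.Binary.Construct.Closure.ReflexiveTransitive using (Star)

-- Terms are well-scoped de Bruijn terms (this realises "up to α-conversion").
-- Index 0 refers to the innermost binder.

data PCF (n : ℕ) : Set where
  var  : Fin n → PCF n
  lam  : PCF (suc n) → PCF n
  app  : PCF n → PCF n → PCF n
  fix  : PCF n → PCF n
  zro  : PCF n
  pred : PCF n → PCF n
  succ : PCF n → PCF n
  ifz  : PCF n → PCF n → PCF n → PCF n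

numP : ∀ {k} → ℕ → PCF k
numP zero    = zro
numP (suc n) = succ (numP n)

extR : ∀ {n m} → (Fin n → Fin m) → Fin (suc n) → Fin (suc m)
extR ρ F.zero    = F.zero
extR ρ (F.suc i) = F.suc (ρ i)

renP : ∀ {n m} → (Fin n → Fin m) → PCF n → PCF m
renP ρ (var i)     = var (ρ i)
renP ρ (lam P)     = lam (renP (extR ρ) P)
renP ρ (app P Q)   = app (renP ρ P) (renP ρ Q)
renP ρ (fix P)     = fix (renP ρ P)
renP ρ zro         = zro
renP ρ (pred P)    = pred (renP ρ P)
renP ρ (succ P)    = succ (renP ρ P)
renP ρ (ifz P Q R) = ifz (renP ρ P) (renP ρ Q) (renP ρ R)

extS : ∀ {n m} → (Fin n → PCF m) → Fin (suc n) → PCF (suc m)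
extS s F.zero    = var F.zero
extS s (F.suc i) = renP F.suc (s i)

subP : ∀ {n m} → (Fin n → PCF m) → PCF n → PCF m
subP s (var i)     = s i
subP s (lam P)     = lam (subP (extS s) P)
subP s (app P Q)   = app (subP s P) (subP s Q)
subP s (fix P)     = fix (subP s P)
subP s zro         = zro
subP s (pred P)    = pred (subP s P)
subP s (succ P)    = succ (subP s P)
subP s (ifz P Q R) = ifz (subP s P) (subP s Q) (subP s R)

single : ∀ {n} → PCF n → Fin (suc n) → PCF n
single Q F.zero    = Q
single Q (F.suc i) = var i

_[_]P : ∀ {n} → PCF (suc n) → PCF n → PCF n
P [ Q ]P = subP (single Q) P

data PCtx : Set where
  □     : PCtx
  appE  : PCtx → PCF 0 → PCtx
  predE : PCtx → PCtx
  succE : PCtx → PCtx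
  ifzE  : PCtx → PCF 0 → PCF 0 → PCtx

plugP : PCtx → PCF 0 → PCF 0
plugP □ P            = P
plugP (appE E Q) P   = app (plugP E P) Q
plugP (predE E) P    = pred (plugP E P)
plugP (succE E) P    = succ (plugP E P)
plugP (ifzE E Q R) P = ifz (plugP E P) Q R

data _→PCF_ : PCF 0 → PCF 0 → Set where
  β     : ∀ E P Q → plugP E (app (lam P) Q) →PCF plugP E (P [ Q ]P)
  fixβ  : ∀ E P → plugP E (fix P) →PCF plugP E (app P (fix P))
  predS : ∀ E n → plugP E (pred (succ (numP n))) →PCF plugP E (numP n)
  pred0 : ∀ E → plugP E (pred zro) →PCF plugP E zro
  ifz0  : ∀ E P₁ P₂ → plugP E (ifz zro P₁ P₂) →PCF plugP E P₁
  ifzS  : ∀ E n P₁ P₂ → plugP E (ifz (numP (suc n)) P₁ P₂) →PCF plugP E P₂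

_↠PCF_ : PCF 0 → PCF 0 → Set
_↠PCF_ = Star _→PCF_

-- EPCF: PCF plus explicit substitutions  esub M N = M⟨N/x⟩,
-- where x (index 0) is bound in M.

data EPCF (n : ℕ) : Set where
  var  : Fin n → EPCF n
  lam  : EPCF (suc n) → EPCF n
  app  : EPCF n → EPCF n → EPCF n
  fix  : EPCF n → EPCF n
  zro  : EPCF n
  pred : EPCF n → EPCF n
  succ : EPCF n → EPCF n
  ifz  : EPCF n → EPCF n → EPCF n → EPCF n
  esub : EPCF (suc n) → EPCF n → EPCF n

numE : ∀ {k} → ℕ → EPCF k
numE zero    = zro
numE (suc n) = succ (numE n)

renE : ∀ {n m} → (Fin n → Fin m) → EPCF n → EPCF m
renE ρ (var i)     = var (ρ i)
renE ρ (lam M)     = lam (renE (extR ρ) M)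
renE ρ (app M N)   = app (renE ρ M) (renE ρ N)
renE ρ (fix M)     = fix (renE ρ M)
renE ρ zro         = zro
renE ρ (pred M)    = pred (renE ρ M)
renE ρ (succ M)    = succ (renE ρ M)
renE ρ (ifz L M N) = ifz (renE ρ L) (renE ρ M) (renE ρ N)
renE ρ (esub M N)  = esub (renE (extR ρ) M) (renE ρ N)

wk : ∀ {m} → EPCF 0 → EPCF m
wk = renE (λ ())

Closed : ∀ {n} → EPCF n → Set
Closed N = Σ (EPCF 0) (λ N₀ → wk N₀ ≡ N)

data SubClosed : ∀ {n} → EPCF n → Set where
  var  : ∀ {n} (i : Fin n) → SubClosed (var i)
  lam  : ∀ {n} {M : EPCF (suc n)} → SubClosed M → SubClosed (lam M)
  app  : ∀ {n} {M N : EPCF n} → SubClosed M → SubClosed N → SubClosed (app M N)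
  fix  : ∀ {n} {M : EPCF n} → SubClosed M → SubClosed (fix M)
  zro  : ∀ {n} → SubClosed (zro {n})
  pred : ∀ {n} {M : EPCF n} → SubClosed M → SubClosed (pred M)
  succ : ∀ {n} {M : EPCF n} → SubClosed M → SubClosed (succ M)
  ifz  : ∀ {n} {L M N : EPCF n} → SubClosed L → SubClosed M → SubClosed N
       → SubClosed (ifz L M N)
  esub : ∀ {n} {M : EPCF (suc n)} {N : EPCF n} → SubClosed M → Closed N → SubClosed N
       → SubClosed (esub M N)

Program : EPCF 0 → Set
Program M = SubClosed M

-- M^σ for σ = ⟨N₁/x₁⟩⋯⟨Nₙ/xₙ⟩ given as the list N₁ ∷ ⋯ ∷ Nₙ ∷ [] of closed terms;
-- x₁ is the innermost binder (index 0 in M), xₙ the outermost; k further outer variables.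
_^_ : ∀ {k} → (σ : List (EPCF 0)) → EPCF (length σ + k) → EPCF k
_^_ [] M       = M
_^_ (N ∷ σ) M  = σ ^ esub M (wk N)

-- renaming used for (λx.M)^σ N → M^σ⟨N/x⟩: in λx.M under σ, x is the innermost
-- variable of M; in M^σ⟨N/x⟩ it is the outermost one.
rot : ∀ n k → Fin (suc (n + k)) → Fin (n + suc k)
rot n k F.zero    = n ↑ʳ F.zero
rot n k (F.suc i) = [ (λ a → a ↑ˡ suc k) , (λ b → n ↑ʳ F.suc b) ] (splitAt n i)

data ECtx : Set where
  □     : ECtx
  appE  : ECtx → EPCF 0 → ECtx
  predE : ECtx → ECtx
  succE : ECtx → ECtx
  ifzE  : ECtx → EPCF 0 → EPCF 0 → ECtx

plugE : ECtx → EPCF 0 → EPCF 0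
plugE □ M            = M
plugE (appE E N) M   = app (plugE E M) N
plugE (predE E) M    = pred (plugE E M)
plugE (succE E) M    = succ (plugE E M)
plugE (ifzE E N P) M = ifz (plugE E M) N P

data _→wh_ : EPCF 0 → EPCF 0 → Set where
  β     : ∀ E (σ : List (EPCF 0)) (M : EPCF (suc (length σ + 0))) N →
          plugE E (app (σ ^ lam M) N) →wh
          plugE E (esub (σ ^ renE (rot (length σ) 0) M) N)
  pred0 : ∀ E → plugE E (pred zro) →wh plugE E zro
  predS : ∀ E n → plugE E (pred (numE (suc n))) →wh plugE E (numE n)
  ifz0  : ∀ E M N → plugE E (ifz zro M N) →wh plugE E M
  ifzS  : ∀ E n M N → plugE E (ifz (numE (suc n)) M N) →wh plugE E N
  fixβ  : ∀ E M → plugE E (fix M) →wh plugE E (app M (fix M))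
  -- percolation steps (σ nonempty; for pVar this is forced by j : Fin (length σ)).  In the closed setting every variable
  -- x^σ lies in dom σ, so the rule y^σ → y (y ∉ dom σ) has no instances.
  pVar  : ∀ E (σ : List (EPCF 0)) (j : Fin (length σ)) →
          plugE E (σ ^ var (j ↑ˡ 0)) →wh plugE E (lookup σ j)
  pZro  : ∀ E N σ → plugE E ((N ∷ σ) ^ zro) →wh plugE E zro
  pApp  : ∀ E N σ M M' → plugE E ((N ∷ σ) ^ app M M') →wh
          plugE E (app ((N ∷ σ) ^ M) ((N ∷ σ) ^ M'))
  pPred : ∀ E N σ M → plugE E ((N ∷ σ) ^ pred M) →wh plugE E (pred ((N ∷ σ) ^ M))
  pSucc : ∀ E N σ M → plugE E ((N ∷ σ) ^ succ M) →wh plugE E (succ ((N ∷ σ) ^ M))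
  pIfz  : ∀ E N σ L M M' → plugE E ((N ∷ σ) ^ ifz L M M') →wh
          plugE E (ifz ((N ∷ σ) ^ L) ((N ∷ σ) ^ M) ((N ∷ σ) ^ M'))
  pFix  : ∀ E N σ M → plugE E ((N ∷ σ) ^ fix M) →wh plugE E (fix ((N ∷ σ) ^ M))

_↠wh_ : EPCF 0 → EPCF 0 → Set
_↠wh_ = Star _→wh_

collapse : ∀ {n} → EPCF n → PCF n
collapse (var i)     = var i
collapse (lam M)     = lam (collapse M)
collapse (app M N)   = app (collapse M) (collapse N)
collapse (fix M)     = fix (collapse M)
collapse zro         = zro
collapse (pred M)    = pred (collapse M)
collapse (succ M)    = succ (collapse M)
collapse (ifz L M N) = ifz (collapse L) (collapse M) (collapse N)
collapse (esub M N)  = collapse M [ collapse N ]P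

-- Collapse is a simulation: a computation step of weak-head reduction collapses to exactly
-- one PCF step in the collapsed evaluation context, and a percolation step collapses to no
-- step at all, because it only moves an explicit substitution that collapse performs anyway.
-- The only real work is the β-step, where the environment σ of λx.M is split off and x is
-- rotated from innermost to outermost position; collapsing σ to a simultaneous substitution
-- shows that both sides of the step substitute the same terms for the same variables.
module Submission where

open import Defs
open import Data.Nat using (ℕ; zero; suc; _+_)
open import Data.Fin using (Fin; _↑ˡ_; _↑ʳ_; splitAt)
import Data.Fin as F
open import Data.Fin.Properties using (splitAt⁻¹-↑ˡ; splitAt⁻¹-↑ʳ)
open import Data.Sum using (inj₁; inj₂)
open import Function using (_∘′_)
open import Data.List using (List; []; _∷_; length; lookup)
open import Relation.Binary.PropositionalEquality
open import Relation.Binary.Construct.Closure.ReflexiveTransitive using (ε; _◅_; kleisliStar)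

ifz-cong : ∀ {n} {L L' M M' N N' : PCF n} → L ≡ L' → M ≡ M' → N ≡ N' → ifz L M N ≡ ifz L' M' N'
ifz-cong refl refl refl = refl

renP-renP : ∀ {n m l} {ρ : Fin m → Fin l} {ρ' : Fin n → Fin m} {τ : Fin n → Fin l} →
            (∀ i → ρ (ρ' i) ≡ τ i) → ∀ P → renP ρ (renP ρ' P) ≡ renP τ P
renP-renP h (var i)     = cong var (h i)
renP-renP {ρ = ρ} {ρ'} {τ} h (lam P) = cong lam (renP-renP ext P)
  where ext : ∀ i → extR ρ (extR ρ' i) ≡ extR τ i
        ext F.zero    = refl
        ext (F.suc i) = cong F.suc (h i)
renP-renP h (app P Q)   = cong₂ app (renP-renP h P) (renP-renP h Q)
renP-renP h (fix P)     = cong fix (renP-renP h P)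
renP-renP h zro         = refl
renP-renP h (pred P)    = cong pred (renP-renP h P)
renP-renP h (succ P)    = cong succ (renP-renP h P)
renP-renP h (ifz P Q R) = ifz-cong (renP-renP h P) (renP-renP h Q) (renP-renP h R)

renP-id : ∀ {n} {ρ : Fin n → Fin n} → (∀ i → ρ i ≡ i) → ∀ P → renP ρ P ≡ P
renP-id h (var i)     = cong var (h i)
renP-id {ρ = ρ} h (lam P) = cong lam (renP-id ext P)
  where ext : ∀ i → extR ρ i ≡ i
        ext F.zero    = refl
        ext (F.suc i) = cong F.suc (h i)
renP-id h (app P Q)   = cong₂ app (renP-id h P) (renP-id h Q)
renP-id h (fix P)     = cong fix (renP-id h P)
renP-id h zro         = refl
renP-id h (pred P)    = cong pred (renP-id h P)
renP-id h (succ P)    = cong succ (renP-id h P)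
renP-id h (ifz P Q R) = ifz-cong (renP-id h P) (renP-id h Q) (renP-id h R)

subP-renP : ∀ {n m l} {s : Fin m → PCF l} {ρ : Fin n → Fin m} {t : Fin n → PCF l} →
            (∀ i → s (ρ i) ≡ t i) → ∀ P → subP s (renP ρ P) ≡ subP t P
subP-renP h (var i)     = h i
subP-renP {s = s} {ρ} {t} h (lam P) = cong lam (subP-renP ext P)
  where ext : ∀ i → extS s (extR ρ i) ≡ extS t i
        ext F.zero    = refl
        ext (F.suc i) = cong (renP F.suc) (h i)
subP-renP h (app P Q)   = cong₂ app (subP-renP h P) (subP-renP h Q)
subP-renP h (fix P)     = cong fix (subP-renP h P)
subP-renP h zro         = refl
subP-renP h (pred P)    = cong pred (subP-renP h P)
subP-renP h (succ P)    = cong succ (subP-renP h P)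
subP-renP h (ifz P Q R) = ifz-cong (subP-renP h P) (subP-renP h Q) (subP-renP h R)

renP-subP : ∀ {n m l} {ρ : Fin m → Fin l} {s : Fin n → PCF m} {t : Fin n → PCF l} →
            (∀ i → renP ρ (s i) ≡ t i) → ∀ P → renP ρ (subP s P) ≡ subP t P
renP-subP h (var i)     = h i
renP-subP {ρ = ρ} {s} {t} h (lam P) = cong lam (renP-subP ext P)
  where ext : ∀ i → renP (extR ρ) (extS s i) ≡ extS t i
        ext F.zero    = refl
        ext (F.suc i) = trans (renP-renP (λ _ → refl) (s i))
                              (trans (sym (renP-renP (λ _ → refl) (s i))) (cong (renP F.suc) (h i)))
renP-subP h (app P Q)   = cong₂ app (renP-subP h P) (renP-subP h Q)
renP-subP h (fix P)     = cong fix (renP-subP h P)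
renP-subP h zro         = refl
renP-subP h (pred P)    = cong pred (renP-subP h P)
renP-subP h (succ P)    = cong succ (renP-subP h P)
renP-subP h (ifz P Q R) = ifz-cong (renP-subP h P) (renP-subP h Q) (renP-subP h R)

subP-subP : ∀ {n m l} {s : Fin m → PCF l} {t : Fin n → PCF m} {u : Fin n → PCF l} →
            (∀ i → subP s (t i) ≡ u i) → ∀ P → subP s (subP t P) ≡ subP u P
subP-subP h (var i)     = h i
subP-subP {s = s} {t} {u} h (lam P) = cong lam (subP-subP ext P)
  where ext : ∀ i → subP (extS s) (extS t i) ≡ extS u i
        ext F.zero    = refl
        ext (F.suc i) = trans (subP-renP (λ _ → refl) (t i))
                              (trans (sym (renP-subP (λ _ → refl) (t i))) (cong (renP F.suc) (h i)))
subP-subP h (app P Q)   = cong₂ app (subP-subP h P) (subP-subP h Q)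
subP-subP h (fix P)     = cong fix (subP-subP h P)
subP-subP h zro         = refl
subP-subP h (pred P)    = cong pred (subP-subP h P)
subP-subP h (succ P)    = cong succ (subP-subP h P)
subP-subP h (ifz P Q R) = ifz-cong (subP-subP h P) (subP-subP h Q) (subP-subP h R)

subP-var : ∀ {n} {s : Fin n → PCF n} → (∀ i → s i ≡ var i) → ∀ P → subP s P ≡ P
subP-var h (var i)     = h i
subP-var {s = s} h (lam P) = cong lam (subP-var ext P)
  where ext : ∀ i → extS s i ≡ var i
        ext F.zero    = refl
        ext (F.suc i) = cong (renP F.suc) (h i)
subP-var h (app P Q)   = cong₂ app (subP-var h P) (subP-var h Q)
subP-var h (fix P)     = cong fix (subP-var h P)
subP-var h zro         = refl
subP-var h (pred P)    = cong pred (subP-var h P)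
subP-var h (succ P)    = cong succ (subP-var h P)
subP-var h (ifz P Q R) = ifz-cong (subP-var h P) (subP-var h Q) (subP-var h R)

renP-as-subP : ∀ {n m} (ρ : Fin n → Fin m) P → renP ρ P ≡ subP (λ i → var (ρ i)) P
renP-as-subP ρ P = trans (sym (subP-var (λ _ → refl) (renP ρ P))) (subP-renP (λ _ → refl) P)

subP-closed : ∀ {m l} (s : Fin m → PCF l) (P : PCF 0) →
              subP s (renP (λ ()) P) ≡ renP (λ ()) P
subP-closed s P = trans (subP-renP (λ ()) P) (sym (renP-as-subP (λ ()) P))

collapse-renE : ∀ {n m} (ρ : Fin n → Fin m) M → collapse (renE ρ M) ≡ renP ρ (collapse M)
collapse-renE ρ (var i)     = refl
collapse-renE ρ (lam M)     = cong lam (collapse-renE (extR ρ) M)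
collapse-renE ρ (app M N)   = cong₂ app (collapse-renE ρ M) (collapse-renE ρ N)
collapse-renE ρ (fix M)     = cong fix (collapse-renE ρ M)
collapse-renE ρ zro         = refl
collapse-renE ρ (pred M)    = cong pred (collapse-renE ρ M)
collapse-renE ρ (succ M)    = cong succ (collapse-renE ρ M)
collapse-renE ρ (ifz L M N) =
  ifz-cong (collapse-renE ρ L) (collapse-renE ρ M) (collapse-renE ρ N)
collapse-renE ρ (esub M N) rewrite collapse-renE (extR ρ) M | collapse-renE ρ N =
  trans (subP-renP single-extR (collapse M)) (sym (renP-subP (λ _ → refl) (collapse M)))
  where single-extR : ∀ i → single (renP ρ (collapse N)) (extR ρ i) ≡ renP ρ (single (collapse N) i)
        single-extR F.zero    = refl
        single-extR (F.suc i) = refl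

collapse-numE : ∀ {k} n → collapse (numE {k} n) ≡ numP n
collapse-numE zero    = refl
collapse-numE (suc n) = cong succ (collapse-numE n)

collapseCtx : ECtx → PCtx
collapseCtx □            = □
collapseCtx (appE E N)   = appE (collapseCtx E) (collapse N)
collapseCtx (predE E)    = predE (collapseCtx E)
collapseCtx (succE E)    = succE (collapseCtx E)
collapseCtx (ifzE E N P) = ifzE (collapseCtx E) (collapse N) (collapse P)

collapse-plugE : ∀ E M → collapse (plugE E M) ≡ plugP (collapseCtx E) (collapse M)
collapse-plugE □ M            = refl
collapse-plugE (appE E N) M   = cong (λ X → app X (collapse N)) (collapse-plugE E M)
collapse-plugE (predE E) M    = cong pred (collapse-plugE E M)
collapse-plugE (succE E) M    = cong succ (collapse-plugE E M)
collapse-plugE (ifzE E N P) M = cong (λ X → ifz X (collapse N) (collapse P)) (collapse-plugE E M)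

collapseEnv : ∀ {k} (σ : List (EPCF 0)) → Fin (length σ + k) → PCF k
collapseEnv []      = var
collapseEnv (N ∷ σ) i = subP (collapseEnv σ) (single (collapse (wk N)) i)

collapse-^ : ∀ {k} σ (M : EPCF (length σ + k)) → collapse (σ ^ M) ≡ subP (collapseEnv σ) (collapse M)
collapse-^ []      M = sym (subP-var (λ _ → refl) (collapse M))
collapse-^ (N ∷ σ) M = trans (collapse-^ σ (esub M (wk N))) (subP-subP (λ _ → refl) (collapse M))

collapseEnv-↑ˡ : ∀ {k} σ (j : Fin (length σ)) →
                 collapseEnv {k} σ (j ↑ˡ k) ≡ renP (λ ()) (collapse (lookup σ j))
collapseEnv-↑ˡ (N ∷ σ) F.zero    =
  trans (cong (subP (collapseEnv σ)) (collapse-renE (λ ()) N)) (subP-closed _ (collapse N))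
collapseEnv-↑ˡ (N ∷ σ) (F.suc j) = collapseEnv-↑ˡ σ j

collapseEnv-↑ʳ : ∀ {k} σ (i : Fin k) → collapseEnv σ (length σ ↑ʳ i) ≡ var i
collapseEnv-↑ʳ []      i = refl
collapseEnv-↑ʳ (N ∷ σ) i = collapseEnv-↑ʳ σ i

collapseEnv-rot : ∀ {k} σ (i : Fin (suc (length σ + k))) →
                  collapseEnv σ (rot (length σ) k i) ≡ extS (collapseEnv σ) i
collapseEnv-rot σ F.zero = collapseEnv-↑ʳ σ F.zero
collapseEnv-rot {k} σ (F.suc i) with splitAt (length σ) i in eq
... | inj₁ j = begin
  collapseEnv σ (j ↑ˡ suc k)                       ≡⟨ collapseEnv-↑ˡ σ j ⟩
  renP (λ ()) (collapse (lookup σ j))              ≡⟨ renP-renP (λ ()) _ ⟨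
  renP F.suc (renP (λ ()) (collapse (lookup σ j))) ≡⟨ cong (renP F.suc) (collapseEnv-↑ˡ σ j) ⟨
  renP F.suc (collapseEnv σ (j ↑ˡ k))              ≡⟨ cong (renP F.suc ∘′ collapseEnv σ) (splitAt⁻¹-↑ˡ eq) ⟩
  renP F.suc (collapseEnv σ i)                     ∎
  where open ≡-Reasoning
... | inj₂ b = begin
  collapseEnv σ (length σ ↑ʳ F.suc b)        ≡⟨ collapseEnv-↑ʳ σ (F.suc b) ⟩
  var (F.suc b)                              ≡⟨ cong (renP F.suc) (collapseEnv-↑ʳ σ b) ⟨
  renP F.suc (collapseEnv σ (length σ ↑ʳ b)) ≡⟨ cong (renP F.suc ∘′ collapseEnv σ) (splitAt⁻¹-↑ʳ eq) ⟩
  renP F.suc (collapseEnv σ i)               ∎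
  where open ≡-Reasoning

_⇝_ : PCF 0 → PCF 0 → Set
P ⇝ Q = ∀ E → plugP E P →PCF plugP E Q

collapse-β : ∀ σ M N →
             collapse (app (σ ^ lam M) N) ⇝ collapse (esub (σ ^ renE (rot (length σ) 0) M) N)
collapse-β σ M N E
  rewrite collapse-^ σ (lam M) | collapse-^ σ (renE (rot (length σ) 0) M)
        | collapse-renE (rot (length σ) 0) M
  = subst (λ P → plugP E (app (lam body) (collapse N)) →PCF plugP E (P [ collapse N ]P))
          (sym (subP-renP (collapseEnv-rot σ) (collapse M))) (β E body (collapse N))
  where body : PCF 1
        body = subP (extS (collapseEnv σ)) (collapse M)

contract-in : ∀ E {M M'} → collapse M ⇝ collapse M' → collapse (plugE E M) →PCF collapse (plugE E M')
contract-in E {M} {M'} r rewrite collapse-plugE E M | collapse-plugE E M' = r (collapseCtx E)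

percolate-in : ∀ E {M M'} → collapse M ≡ collapse M' → collapse (plugE E M) ↠PCF collapse (plugE E M')
percolate-in E {M} {M'} e rewrite collapse-plugE E M | collapse-plugE E M' | e = ε

collapse-→wh : ∀ {M M'} → M →wh M' → collapse M ↠PCF collapse M'
collapse-→wh (β E σ M N)    = contract-in E (collapse-β σ M N) ◅ ε
collapse-→wh (pred0 E)      = contract-in E pred0 ◅ ε
collapse-→wh (predS E n)    = contract-in E predS-redex ◅ ε
  where predS-redex : collapse (pred (numE (suc n))) ⇝ collapse (numE n)
        predS-redex E' rewrite collapse-numE {0} n = predS E' n
collapse-→wh (ifz0 E M N)   = contract-in E (λ E' → ifz0 E' _ _) ◅ ε
collapse-→wh (ifzS E n M N) = contract-in E ifzS-redex ◅ ε
  where ifzS-redex : collapse (ifz (numE (suc n)) M N) ⇝ collapse N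
        ifzS-redex E' rewrite collapse-numE {0} n = ifzS E' n _ _
collapse-→wh (fixβ E M)     = contract-in E (λ E' → fixβ E' _) ◅ ε
collapse-→wh (pVar E σ j)   = percolate-in E (begin
  collapse (σ ^ var (j ↑ˡ 0))           ≡⟨ collapse-^ σ (var (j ↑ˡ 0)) ⟩
  collapseEnv σ (j ↑ˡ 0)                ≡⟨ collapseEnv-↑ˡ σ j ⟩
  renP (λ ()) (collapse (lookup σ j))   ≡⟨ renP-id (λ ()) _ ⟩
  collapse (lookup σ j)                 ∎)
  where open ≡-Reasoning
collapse-→wh (pZro E N σ)   = percolate-in E (collapse-^ (N ∷ σ) zro)
collapse-→wh (pApp E N σ M M') = percolate-in E (trans (collapse-^ (N ∷ σ) (app M M'))
  (sym (cong₂ app (collapse-^ (N ∷ σ) M) (collapse-^ (N ∷ σ) M'))))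
collapse-→wh (pPred E N σ M) = percolate-in E (trans (collapse-^ (N ∷ σ) (pred M))
  (sym (cong pred (collapse-^ (N ∷ σ) M))))
collapse-→wh (pSucc E N σ M) = percolate-in E (trans (collapse-^ (N ∷ σ) (succ M))
  (sym (cong succ (collapse-^ (N ∷ σ) M))))
collapse-→wh (pIfz E N σ L M M') = percolate-in E (trans (collapse-^ (N ∷ σ) (ifz L M M'))
  (sym (ifz-cong (collapse-^ (N ∷ σ) L) (collapse-^ (N ∷ σ) M) (collapse-^ (N ∷ σ) M'))))
collapse-→wh (pFix E N σ M) = percolate-in E (trans (collapse-^ (N ∷ σ) (fix M))
  (sym (cong fix (collapse-^ (N ∷ σ) M))))

collapse-↠wh : ∀ {M M'} → M ↠wh M' → collapse M ↠PCF collapse M'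
collapse-↠wh = kleisliStar collapse collapse-→wh

corollary2p20 : (M : EPCF 0) → Program M → (n : ℕ) →
    M ↠wh numE n → collapse M ↠PCF numP n
corollary2p20 M _ n M↠n = subst (collapse M ↠PCF_) (collapse-numE n) (collapse-↠wh M↠n)
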